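{- Let $n\ge 3$ and let $k$ be an integer with $0\le k\le n-2$. Then $\mu_k(C_n)=\min\{n,2k+3\}$, where $C_n$ is the cycle on $n$ vertices.
   Context: For a graph $G$, $X\subseteq V(G)$ and an integer $k\ge 0$, two vertices $u,v$ are $(X,k)$-visible if there exists a shortest $(u,v)$-path in $G$ having at most $k$ internal vertices in $X$. $X$ is a mutual $k$-visible set if every pair of distinct vertices of $X$ is $(X,k)$-visible; $\mu_k(G)$ is the maximum cardinality of a mutual $k$-visible set in $G$. -}

module Defs where

open import Data.Nat using (ℕ; zero; suc; _+_; _∸_; _≤_)
open import Data.Fin using (Fin; toℕ)
open import Data.Fin.Subset using (Subset; _∈_; ∣_∣)
open import Data.Fin.Subset.Properties using (_∈?_)
open import Data.List using (List; []; _∷_; length; filter)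
open import Data.Product using (Σ; ∃; _×_; _,_)
open import Data.Sum using (_⊎_)
open import Relation.Binary.PropositionalEquality using (_≡_; _≢_)

Graph : ℕ → Set₁
Graph n = Fin n → Fin n → Set

Cycle : (n : ℕ) → Graph n
Cycle n i j =
  (toℕ j ≡ suc (toℕ i)) ⊎ (toℕ i ≡ suc (toℕ j))
  ⊎ ((toℕ i ≡ 0 × suc (toℕ j) ≡ n) ⊎ (toℕ j ≡ 0 × suc (toℕ i) ≡ n))

module _ {n : ℕ} (G : Graph n) where

  data Walk : Fin n → Fin n → Set where
    [] : ∀ {u} → Walk u u
    _∷_ : ∀ {u w v} → G u w → Walk w v → Walk u v

  len : ∀ {u v} → Walk u v → ℕ
  len [] = 0
  len (_ ∷ p) = suc (len p)

  initVerts : ∀ {u v} → Walk u v → List (Fin n)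
  initVerts [] = []
  initVerts (_∷_ {u} _ p) = u ∷ initVerts p

  internal : ∀ {u v} → Walk u v → List (Fin n)
  internal [] = []
  internal (_ ∷ p) = initVerts p

  -- a shortest (u,v)-path: a (u,v)-walk of minimum length
  -- (a minimum-length walk is necessarily a path)
  IsShortest : ∀ {u v} → Walk u v → Set
  IsShortest {u} {v} p = (q : Walk u v) → len p ≤ len q

  countIn : Subset n → List (Fin n) → ℕ
  countIn X xs = length (filter (_∈? X) xs)

  Visible : Subset n → ℕ → Fin n → Fin n → Set
  Visible X k u v = Σ (Walk u v) λ p → IsShortest p × countIn X (internal p) ≤ k

  MutualVisible : ℕ → Subset n → Set
  MutualVisible k X = ∀ u v → u ∈ X → v ∈ X → u ≢ v → Visible X k u v

  IsMu : ℕ → ℕ → Set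
  IsMu k m = (Σ (Subset n) λ X → MutualVisible k X × ∣ X ∣ ≡ m)
           × (∀ X → MutualVisible k X → ∣ X ∣ ≤ m)

-- Weigh a walk by the sum of w over the vertices it leaves. The smaller of the w-weights
-- of the two arcs from x to y drops by at most w a along an edge a ~ c, so it bounds the
-- weight of every (x,y)-walk from below; with w = 1 this shows that a walk along the
-- shorter arc is a shortest path.
--
-- If ∣X∣ ≥ 2k+4, the first and the (k+3)-rd member of X have at least k+2 members of X
-- on either arc (the start counted), so every walk between them passes k+1 of them.
--
-- Conversely let m = min(n, 2k+3) and X = {t : ⌊(t+1)m/n⌋ > ⌊tm/n⌋}. For u, v ∈ X, an arc
-- of length ℓ carrying c members of X satisfies |ℓm − cn| < m, so the arc with fewer
-- members is no longer than the other, and it carries at most k+1 of them, u included.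
module Submission where

open import Defs
open import Data.Nat using (ℕ; _+_; _*_; _∸_; _≤_; _⊓_)
open import Data.Nat.Base using (zero; suc; _<_; z≤n; s≤s; s≤s⁻¹; NonZero; >-nonZero)
open import Data.Nat.Properties
open import Data.Nat.DivMod using (_/_; _%_; m≡m%n+[m/n]*n; m%n<n; +-distrib-/-∣ʳ; /-congˡ; /-monoˡ-≤; 0/n≡0; m*n/n≡m; m<n⇒m/n≡0; m/n≡1+[m∸n]/n)
open import Data.Nat.Divisibility using (n∣m*n)
open import Data.Nat.Solver using (module +-*-Solver)
open import Data.Bool.Base using (Bool; true; false; if_then_else_)
open import Data.Fin.Base using (Fin; toℕ; fromℕ; fromℕ<; inject₁) renaming (zero to fzero; suc to fsuc)
open import Data.Fin.Properties using (toℕ<n; toℕ-fromℕ; toℕ-fromℕ<; toℕ-inject₁; toℕ-injective) renaming (_≟_ to _≟ᶠ_)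
open import Data.Fin.Subset using (Subset; _∈_; _∉_; ∣_∣)
open import Data.Fin.Subset.Properties using (_∈?_; ∣p∣≤n)
open import Data.Vec.Base using (_∷_; []; here; there; tabulate)
open import Data.Vec.Properties using (lookup∘tabulate; []=⇒lookup)
open import Data.Product using (∃; ∃₂; Σ; _×_; _,_)
open import Data.Sum using (_⊎_; inj₁; inj₂)
open import Function using (_∘_; const)
open import Relation.Binary.Definitions using (Tri; tri<; tri≈; tri>)
open import Relation.Binary.PropositionalEquality
open import Relation.Nullary using (yes; no; does)
open import Relation.Nullary.Decidable using (dec-true; dec-false)
open import Relation.Nullary.Negation using (contradiction)
open +-*-Solver using (solve; _:+_; _:*_; _:=_; con)

prefixSum : (ℕ → ℕ) → ℕ → ℕ
prefixSum w zero = 0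
prefixSum w (suc t) = prefixSum w t + w t

prefixSum-mono : ∀ w {s t} → s ≤ t → prefixSum w s ≤ prefixSum w t
prefixSum-mono w {t = zero} z≤n = ≤-refl
prefixSum-mono w {s} {suc t} s≤1+t with s ≤? t
... | yes s≤t = ≤-trans (prefixSum-mono w s≤t) (m≤m+n _ (w t))
... | no s≰t = ≤-reflexive (cong (prefixSum w) (≤-antisym s≤1+t (≰⇒> s≰t)))

prefixSum-shift : ∀ w t → prefixSum w (suc t) ≡ w 0 + prefixSum (w ∘ suc) t
prefixSum-shift w zero = +-comm 0 (w 0)
prefixSum-shift w (suc t) = trans (cong (_+ w (suc t)) (prefixSum-shift w t)) (+-assoc (w 0) _ _)

prefixSum-const-1 : ∀ t → prefixSum (const 1) t ≡ t
prefixSum-const-1 zero = refl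
prefixSum-const-1 (suc t) = trans (cong (_+ 1) (prefixSum-const-1 t)) (+-comm t 1)

range-peel-first : ∀ w {a c} → a < c → prefixSum w c ∸ prefixSum w a ≡ w a + (prefixSum w c ∸ prefixSum w (suc a))
range-peel-first w {a} {c} a<c = begin
  S c ∸ S a                 ≡⟨ m+[n∸m]≡n w[a]≤ ⟨
  w a + (S c ∸ S a ∸ w a)   ≡⟨ cong (w a +_) (∸-+-assoc (S c) (S a) (w a)) ⟩
  w a + (S c ∸ S (suc a))   ∎
  where
  open ≡-Reasoning
  S = prefixSum w
  w[a]≤ : w a ≤ S c ∸ S a
  w[a]≤ = m+n≤o⇒m≤o∸n (w a) (subst (_≤ S c) (+-comm (S a) (w a)) (prefixSum-mono w a<c))

range-peel-last : ∀ w {a c} → a ≤ c → prefixSum w (suc c) ∸ prefixSum w a ≡ w c + (prefixSum w c ∸ prefixSum w a)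
range-peel-last w {a} {c} a≤c = trans (+-∸-comm (w c) (prefixSum-mono w a≤c)) (+-comm _ (w c))

fromBool : Bool → ℕ
fromBool b = if b then 1 else 0

indicator : ∀ {n} → Subset n → ℕ → ℕ
indicator [] t = 0
indicator (b ∷ X) zero = fromBool b
indicator (b ∷ X) (suc t) = indicator X t

indicator-∈ : ∀ {n} {X : Subset n} {x} → x ∈ X → indicator X (toℕ x) ≡ 1
indicator-∈ here = refl
indicator-∈ (there x∈X) = indicator-∈ x∈X

indicator-∉ : ∀ {n} {X : Subset n} {x} → x ∉ X → indicator X (toℕ x) ≡ 0
indicator-∉ {X = true ∷ X} {fzero} x∉X = contradiction here x∉X
indicator-∉ {X = false ∷ X} {fzero} x∉X = refl
indicator-∉ {X = b ∷ X} {fsuc x} x∉X = indicator-∉ (x∉X ∘ there)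

indicator-tabulate : ∀ {n} (f : ℕ → Bool) {t} → t < n → indicator (tabulate {n = n} (f ∘ toℕ)) t ≡ fromBool (f t)
indicator-tabulate {suc n} f {zero} _ = refl
indicator-tabulate {suc n} f {suc t} t<n = indicator-tabulate (f ∘ suc) (s≤s⁻¹ t<n)

∣∣≡prefixSum-indicator : ∀ {n} (X : Subset n) → ∣ X ∣ ≡ prefixSum (indicator X) n
∣∣≡prefixSum-indicator [] = refl
∣∣≡prefixSum-indicator {suc n} (true ∷ X) =
  trans (cong suc (∣∣≡prefixSum-indicator X)) (sym (prefixSum-shift (indicator (true ∷ X)) n))
∣∣≡prefixSum-indicator {suc n} (false ∷ X) =
  trans (∣∣≡prefixSum-indicator X) (sym (prefixSum-shift (indicator (false ∷ X)) n))

member-of-rank : ∀ {n} (X : Subset n) {j} → j < ∣ X ∣ → ∃ λ x → x ∈ X × prefixSum (indicator X) (toℕ x) ≡ j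
member-of-rank (true ∷ X) {zero} _ = fzero , here , refl
member-of-rank (true ∷ X) {suc j} j<∣X∣ with member-of-rank X (s≤s⁻¹ j<∣X∣)
... | x , x∈X , rank = fsuc x , there x∈X , trans (prefixSum-shift (indicator (true ∷ X)) (toℕ x)) (cong suc rank)
member-of-rank (false ∷ X) j<∣X∣ with member-of-rank X j<∣X∣
... | x , x∈X , rank = fsuc x , there x∈X , trans (prefixSum-shift (indicator (false ∷ X)) (toℕ x)) rank

weight : ∀ {n} {G : Graph n} {u v} → (ℕ → ℕ) → Walk G u v → ℕ
weight w [] = 0
weight w (_∷_ {u} _ p) = w (toℕ u) + weight w p

len≡weight-1 : ∀ {n} {G : Graph n} {u v} (p : Walk G u v) → len G p ≡ weight (const 1) p
len≡weight-1 [] = refl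
len≡weight-1 (_ ∷ p) = cong suc (len≡weight-1 p)

countIn≡weight-indicator : ∀ {n} {G : Graph n} (X : Subset n) {u v} (p : Walk G u v) →
  countIn G X (initVerts G p) ≡ weight (indicator X) p
countIn≡weight-indicator X [] = refl
countIn≡weight-indicator X (_∷_ {u} _ p) with u ∈? X
... | yes u∈X = trans (cong suc (countIn≡weight-indicator X p)) (cong (_+ weight (indicator X) p) (sym (indicator-∈ u∈X)))
... | no u∉X = trans (countIn≡weight-indicator X p) (cong (_+ weight (indicator X) p) (sym (indicator-∉ u∉X)))

weight-indicator≡suc-countIn : ∀ {n} {G : Graph n} {X : Subset n} {u v} → u ∈ X → u ≢ v →
  (p : Walk G u v) → weight (indicator X) p ≡ suc (countIn G X (internal G p))
weight-indicator≡suc-countIn u∈X u≢u [] = contradiction refl u≢u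
weight-indicator≡suc-countIn {X = X} u∈X _ (_ ∷ p) =
  cong₂ _+_ (indicator-∈ u∈X) (sym (countIn≡weight-indicator X p))

⊓-peel : ∀ {c U D U′ D′} → U ≡ c + U′ → D ≤ c + D′ ⊎ U′ ≡ 0 → U ⊓ D ≤ c + (U′ ⊓ D′)
⊓-peel {c} {U} {D} {U′} {D′} U≡ (inj₁ D≤) =
  subst (U ⊓ D ≤_) (sym (+-distribˡ-⊓ c U′ D′)) (⊓-mono-≤ (≤-reflexive U≡) D≤)
⊓-peel {c} {U} {D} {U′} {D′} U≡ (inj₂ U′≡0) = begin
  U ⊓ D          ≤⟨ m⊓n≤m U D ⟩
  U              ≡⟨ trans U≡ (cong (c +_) U′≡0) ⟩
  c + 0          ≤⟨ +-monoʳ-≤ c z≤n ⟩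
  c + (U′ ⊓ D′)  ∎
  where open ≤-Reasoning

⊓-peel′ : ∀ {c U D U′ D′} → D ≡ c + D′ → U ≤ c + U′ ⊎ D′ ≡ 0 → U ⊓ D ≤ c + (U′ ⊓ D′)
⊓-peel′ {c} {U} {D} {U′} {D′} D≡ h =
  subst₂ (λ s t → s ≤ c + t) (⊓-comm D U) (⊓-comm D′ U′) (⊓-peel D≡ h)

-- up x y is the w-weight of the vertices x, x+1, …, y-1 (mod n) and down x y that
-- of x, x-1, …, y+1: the vertices a walk along the respective arc from x to y leaves.
module Arcs (n : ℕ) (w : ℕ → ℕ) where

  private
    S : ℕ → ℕ
    S = prefixSum w

  up : ℕ → ℕ → ℕ
  up x y with x ≤? y
  ... | yes _ = S y ∸ S x
  ... | no _ = (S n ∸ S x) + S y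

  down : ℕ → ℕ → ℕ
  down x y with y ≤? x
  ... | yes _ = S (suc x) ∸ S (suc y)
  ... | no _ = S (suc x) + (S n ∸ S (suc y))

  arcDist : ℕ → ℕ → ℕ
  arcDist x y = up x y ⊓ down x y

  up-≤ : ∀ {x y} → x ≤ y → up x y ≡ S y ∸ S x
  up-≤ {x} {y} x≤y with x ≤? y
  ... | yes _ = refl
  ... | no x≰y = contradiction x≤y x≰y

  up-> : ∀ {x y} → y < x → up x y ≡ (S n ∸ S x) + S y
  up-> {x} {y} y<x with x ≤? y
  ... | yes x≤y = contradiction x≤y (<⇒≱ y<x)
  ... | no _ = refl

  down-≥ : ∀ {x y} → y ≤ x → down x y ≡ S (suc x) ∸ S (suc y)
  down-≥ {x} {y} y≤x with y ≤? x
  ... | yes _ = refl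
  ... | no y≰x = contradiction y≤x y≰x

  down-< : ∀ {x y} → x < y → down x y ≡ S (suc x) + (S n ∸ S (suc y))
  down-< {x} {y} x<y with y ≤? x
  ... | yes y≤x = contradiction y≤x (<⇒≱ x<y)
  ... | no _ = refl

  up-refl : ∀ x → up x x ≡ 0
  up-refl x = trans (up-≤ {x} ≤-refl) (n∸n≡0 (S x))

  down-refl : ∀ x → down x x ≡ 0
  down-refl x = trans (down-≥ {x} ≤-refl) (n∸n≡0 (S (suc x)))

  arcDist-refl-≤ : ∀ x {c} → arcDist x x ≤ c
  arcDist-refl-≤ x = ≤-trans (≤-reflexive (cong (_⊓ down x x) (up-refl x))) z≤n

  other<last : ∀ {x y} → suc x ≡ n → y < n → x ≢ y → y < x
  other<last {x} {y} 1+x≡n y<n x≢y = ≤∧≢⇒< (s≤s⁻¹ (subst (y <_) (sym 1+x≡n) y<n)) (x≢y ∘ sym)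

  open ≤-Reasoning

  up-suc : ∀ {x y} → x ≢ y → suc x < n → up x y ≡ w x + up (suc x) y
  up-suc {x} {y} x≢y 1+x<n with <-cmp x y
  ... | tri≈ _ x≡y _ = contradiction x≡y x≢y
  ... | tri< x<y _ _ = begin-equality
    up x y                           ≡⟨ up-≤ (<⇒≤ x<y) ⟩
    S y ∸ S x                        ≡⟨ range-peel-first w x<y ⟩
    w x + (S y ∸ S (suc x))          ≡⟨ cong (w x +_) (up-≤ x<y) ⟨
    w x + up (suc x) y               ∎
  ... | tri> _ _ y<x = begin-equality
    up x y                           ≡⟨ up-> y<x ⟩
    (S n ∸ S x) + S y                ≡⟨ cong (_+ S y) (range-peel-first w (<-trans (n<1+n x) 1+x<n)) ⟩
    w x + (S n ∸ S (suc x)) + S y    ≡⟨ +-assoc (w x) _ _ ⟩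
    w x + ((S n ∸ S (suc x)) + S y)  ≡⟨ cong (w x +_) (up-> (m<n⇒m<1+n y<x)) ⟨
    w x + up (suc x) y               ∎

  up-wrap : ∀ {x y} → x ≢ y → suc x ≡ n → y < n → up x y ≡ w x + up 0 y
  up-wrap {x} {y} x≢y 1+x≡n y<n = begin-equality
    up x y                           ≡⟨ up-> (other<last 1+x≡n y<n x≢y) ⟩
    (S n ∸ S x) + S y                ≡⟨ cong (λ t → (S t ∸ S x) + S y) 1+x≡n ⟨
    (S (suc x) ∸ S x) + S y          ≡⟨ cong (_+ S y) (m+n∸m≡n (S x) (w x)) ⟩
    w x + S y                        ≡⟨ cong (w x +_) (up-≤ {0} {y} z≤n) ⟨
    w x + up 0 y                     ∎

  down-suc : ∀ {x y} → suc x ≢ y → down (suc x) y ≡ w (suc x) + down x y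
  down-suc {x} {y} 1+x≢y with x <? y
  ... | yes x<y = begin-equality
    down (suc x) y                                  ≡⟨ down-< (≤∧≢⇒< x<y 1+x≢y) ⟩
    S (suc x) + w (suc x) + (S n ∸ S (suc y))       ≡⟨ cong (_+ (S n ∸ S (suc y))) (+-comm (S (suc x)) (w (suc x))) ⟩
    w (suc x) + S (suc x) + (S n ∸ S (suc y))       ≡⟨ +-assoc (w (suc x)) _ _ ⟩
    w (suc x) + (S (suc x) + (S n ∸ S (suc y)))     ≡⟨ cong (w (suc x) +_) (down-< x<y) ⟨
    w (suc x) + down x y                            ∎
  ... | no x≮y = begin-equality
    down (suc x) y                                  ≡⟨ down-≥ {suc x} (m≤n⇒m≤1+n y≤x) ⟩
    S (suc (suc x)) ∸ S (suc y)                     ≡⟨ range-peel-last w (s≤s y≤x) ⟩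
    w (suc x) + (S (suc x) ∸ S (suc y))             ≡⟨ cong (w (suc x) +_) (down-≥ y≤x) ⟨
    w (suc x) + down x y                            ∎
    where
    y≤x : y ≤ x
    y≤x = ≮⇒≥ x≮y

  down-wrap : ∀ {x y} → y ≢ 0 → suc x ≡ n → y < n → down 0 y ≡ w 0 + down x y
  down-wrap {x} {y} y≢0 1+x≡n y<n = begin-equality
    down 0 y                          ≡⟨ down-< (≤∧≢⇒< z≤n (y≢0 ∘ sym)) ⟩
    w 0 + (S n ∸ S (suc y))           ≡⟨ cong (λ t → w 0 + (S t ∸ S (suc y))) 1+x≡n ⟨
    w 0 + (S (suc x) ∸ S (suc y))     ≡⟨ cong (w 0 +_) (down-≥ (s≤s⁻¹ (subst (y <_) (sym 1+x≡n) y<n))) ⟨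
    w 0 + down x y                    ∎

  down-suc-mono : ∀ {x y} → x ≢ y → suc x ≢ y → down x y ≤ down (suc x) y
  down-suc-mono {x} {y} x≢y 1+x≢y with <-cmp x y
  ... | tri≈ _ x≡y _ = contradiction x≡y x≢y
  ... | tri< x<y _ _ = begin
    down x y                                   ≡⟨ down-< x<y ⟩
    S (suc x) + (S n ∸ S (suc y))              ≤⟨ +-monoˡ-≤ _ (prefixSum-mono w (n≤1+n (suc x))) ⟩
    S (suc (suc x)) + (S n ∸ S (suc y))        ≡⟨ down-< (≤∧≢⇒< x<y 1+x≢y) ⟨
    down (suc x) y                             ∎
  ... | tri> _ _ y<x = begin
    down x y                                   ≡⟨ down-≥ (<⇒≤ y<x) ⟩
    S (suc x) ∸ S (suc y)                      ≤⟨ ∸-monoˡ-≤ (S (suc y)) (prefixSum-mono w (n≤1+n (suc x))) ⟩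
    S (suc (suc x)) ∸ S (suc y)                ≡⟨ down-≥ (m≤n⇒m≤1+n (<⇒≤ y<x)) ⟨
    down (suc x) y                             ∎

  down-wrap-mono : ∀ {x y} → suc x ≡ n → y < x → 0 < y → down x y ≤ down 0 y
  down-wrap-mono {x} {y} 1+x≡n y<x 0<y = begin
    down x y                                   ≡⟨ down-≥ (<⇒≤ y<x) ⟩
    S (suc x) ∸ S (suc y)                      ≡⟨ cong (λ t → S t ∸ S (suc y)) 1+x≡n ⟩
    S n ∸ S (suc y)                            ≤⟨ m≤n+m _ (w 0) ⟩
    w 0 + (S n ∸ S (suc y))                    ≡⟨ down-< 0<y ⟨
    down 0 y                                   ∎

  up-suc-antimono : ∀ {x y} → x ≢ y → up (suc x) y ≤ up x y
  up-suc-antimono {x} {y} x≢y with <-cmp x y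
  ... | tri≈ _ x≡y _ = contradiction x≡y x≢y
  ... | tri< x<y _ _ = begin
    up (suc x) y                               ≡⟨ up-≤ x<y ⟩
    S y ∸ S (suc x)                            ≤⟨ ∸-monoʳ-≤ (S y) (prefixSum-mono w (n≤1+n x)) ⟩
    S y ∸ S x                                  ≡⟨ up-≤ (<⇒≤ x<y) ⟨
    up x y                                     ∎
  ... | tri> _ _ y<x = begin
    up (suc x) y                               ≡⟨ up-> (m<n⇒m<1+n y<x) ⟩
    (S n ∸ S (suc x)) + S y                    ≤⟨ +-monoˡ-≤ (S y) (∸-monoʳ-≤ (S n) (prefixSum-mono w (n≤1+n x))) ⟩
    (S n ∸ S x) + S y                          ≡⟨ up-> y<x ⟨
    up x y                                     ∎

  up-wrap-antimono : ∀ {x y} → y < x → up 0 y ≤ up x y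
  up-wrap-antimono {x} {y} y<x = begin
    up 0 y                                     ≡⟨ up-≤ {0} {y} z≤n ⟩
    S y                                        ≤⟨ m≤n+m (S y) _ ⟩
    (S n ∸ S x) + S y                          ≡⟨ up-> y<x ⟨
    up x y                                     ∎

  arcDist-suc : ∀ {x y} → suc x < n → arcDist x y ≤ w x + arcDist (suc x) y
  arcDist-suc {x} {y} 1+x<n with x ≟ y
  ... | yes refl = arcDist-refl-≤ x
  ... | no x≢y = ⊓-peel (up-suc x≢y 1+x<n) down-bound
    where
    down-bound : down x y ≤ w x + down (suc x) y ⊎ up (suc x) y ≡ 0
    down-bound with suc x ≟ y
    ... | yes refl = inj₂ (up-refl (suc x))
    ... | no 1+x≢y = inj₁ (≤-trans (down-suc-mono x≢y 1+x≢y) (m≤n+m _ (w x)))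

  arcDist-wrap : ∀ {x y} → suc x ≡ n → y < n → arcDist x y ≤ w x + arcDist 0 y
  arcDist-wrap {x} {y} 1+x≡n y<n with x ≟ y
  ... | yes refl = arcDist-refl-≤ x
  ... | no x≢y = ⊓-peel (up-wrap x≢y 1+x≡n y<n) down-bound
    where
    down-bound : down x y ≤ w x + down 0 y ⊎ up 0 y ≡ 0
    down-bound with y ≟ 0
    ... | yes refl = inj₂ (up-refl 0)
    ... | no y≢0 = inj₁ (≤-trans (down-wrap-mono 1+x≡n (other<last 1+x≡n y<n x≢y) (≤∧≢⇒< z≤n (y≢0 ∘ sym))) (m≤n+m _ (w x)))

  arcDist-pred : ∀ {x y} → arcDist (suc x) y ≤ w (suc x) + arcDist x y
  arcDist-pred {x} {y} with suc x ≟ y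
  ... | yes refl = arcDist-refl-≤ (suc x)
  ... | no 1+x≢y = ⊓-peel′ (down-suc 1+x≢y) up-bound
    where
    up-bound : up (suc x) y ≤ w (suc x) + up x y ⊎ down x y ≡ 0
    up-bound with x ≟ y
    ... | yes refl = inj₂ (down-refl x)
    ... | no x≢y = inj₁ (≤-trans (up-suc-antimono x≢y) (m≤n+m _ (w (suc x))))

  arcDist-unwrap : ∀ {x y} → suc x ≡ n → y < n → arcDist 0 y ≤ w 0 + arcDist x y
  arcDist-unwrap {x} {y} 1+x≡n y<n with y ≟ 0
  ... | yes refl = arcDist-refl-≤ 0
  ... | no y≢0 = ⊓-peel′ (down-wrap y≢0 1+x≡n y<n) up-bound
    where
    up-bound : up 0 y ≤ w 0 + up x y ⊎ down x y ≡ 0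
    up-bound with x ≟ y
    ... | yes refl = inj₂ (down-refl x)
    ... | no x≢y = inj₁ (≤-trans (up-wrap-antimono (other<last 1+x≡n y<n x≢y)) (m≤n+m _ (w 0)))

  up+up-flip< : ∀ {x y} → x < y → y ≤ n → up x y + up y x ≡ S n
  up+up-flip< {x} {y} x<y y≤n = begin-equality
    up x y + up y x                     ≡⟨ cong₂ _+_ (up-≤ (<⇒≤ x<y)) (up-> x<y) ⟩
    (S y ∸ S x) + ((S n ∸ S y) + S x)   ≡⟨ solve 3 (λ a b c → a :+ (c :+ b) := a :+ b :+ c) refl (S y ∸ S x) (S x) (S n ∸ S y) ⟩
    (S y ∸ S x) + S x + (S n ∸ S y)     ≡⟨ cong (_+ (S n ∸ S y)) (m∸n+n≡m (prefixSum-mono w (<⇒≤ x<y))) ⟩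
    S y + (S n ∸ S y)                   ≡⟨ m+[n∸m]≡n (prefixSum-mono w y≤n) ⟩
    S n                                 ∎

  up+up-flip : ∀ {x y} → x ≢ y → x < n → y < n → up x y + up y x ≡ S n
  up+up-flip {x} {y} x≢y x<n y<n with <-cmp x y
  ... | tri< x<y _ _ = up+up-flip< x<y (<⇒≤ y<n)
  ... | tri≈ _ x≡y _ = contradiction x≡y x≢y
  ... | tri> _ _ y<x = trans (+-comm (up x y) (up y x)) (up+up-flip< y<x (<⇒≤ x<n))

  down≡up-flip : ∀ {x y} → x ≢ y → y < n → w x ≡ w y → down x y ≡ up y x
  down≡up-flip {x} {y} x≢y y<n w[x]≡w[y] with <-cmp x y
  ... | tri≈ _ x≡y _ = contradiction x≡y x≢y
  ... | tri< x<y _ _ = begin-equality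
    down x y                            ≡⟨ down-< x<y ⟩
    S x + w x + (S n ∸ S (suc y))       ≡⟨ cong (λ c → S x + c + (S n ∸ S (suc y))) w[x]≡w[y] ⟩
    S x + w y + (S n ∸ S (suc y))       ≡⟨ solve 3 (λ s c r → s :+ c :+ r := c :+ r :+ s) refl (S x) (w y) (S n ∸ S (suc y)) ⟩
    w y + (S n ∸ S (suc y)) + S x       ≡⟨ cong (_+ S x) (range-peel-first w y<n) ⟨
    (S n ∸ S y) + S x                   ≡⟨ up-> x<y ⟨
    up y x                              ∎
  ... | tri> _ _ y<x = begin-equality
    down x y                            ≡⟨ down-≥ (<⇒≤ y<x) ⟩
    (S x + w x) ∸ (S y + w y)           ≡⟨ cong (λ c → (S x + w x) ∸ (S y + c)) w[x]≡w[y] ⟨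
    (S x + w x) ∸ (S y + w x)           ≡⟨ cong₂ _∸_ (+-comm (S x) (w x)) (+-comm (S y) (w x)) ⟩
    (w x + S x) ∸ (w x + S y)           ≡⟨ [m+n]∸[m+o]≡n∸o (w x) (S x) (S y) ⟩
    S x ∸ S y                           ≡⟨ up-≤ (<⇒≤ y<x) ⟨
    up y x                              ∎

  up+down≡total : ∀ {x y} → x ≢ y → x < n → y < n → w x ≡ w y → up x y + down x y ≡ S n
  up+down≡total {x} {y} x≢y x<n y<n w[x]≡w[y] =
    trans (cong (up x y +_) (down≡up-flip x≢y y<n w[x]≡w[y])) (up+up-flip x≢y x<n y<n)

  arcDist-edge : ∀ {a c : Fin n} {y} → Cycle n a c → y < n → arcDist (toℕ a) y ≤ w (toℕ a) + arcDist (toℕ c) y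
  arcDist-edge {a} {c} (inj₁ c≡1+a) y<n rewrite c≡1+a =
    arcDist-suc (subst (_< n) c≡1+a (toℕ<n c))
  arcDist-edge (inj₂ (inj₁ a≡1+c)) y<n rewrite a≡1+c = arcDist-pred
  arcDist-edge (inj₂ (inj₂ (inj₁ (a≡0 , 1+c≡n)))) y<n rewrite a≡0 = arcDist-unwrap 1+c≡n y<n
  arcDist-edge (inj₂ (inj₂ (inj₂ (c≡0 , 1+a≡n)))) y<n rewrite c≡0 = arcDist-wrap 1+a≡n y<n

  arcDist≤weight : ∀ {a b : Fin n} (p : Walk (Cycle n) a b) → arcDist (toℕ a) (toℕ b) ≤ weight w p
  arcDist≤weight {a} [] = arcDist-refl-≤ (toℕ a)
  arcDist≤weight {a} {b} (e ∷ p) =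
    ≤-trans (arcDist-edge e (toℕ<n b)) (+-monoʳ-≤ (w (toℕ a)) (arcDist≤weight p))

open Arcs

Peel : ∀ n → ((ℕ → ℕ) → ℕ → ℕ → ℕ) → (a b c : Fin n) → Set
Peel n cost a b c = ∀ w → cost w (toℕ a) (toℕ b) ≡ w (toℕ a) + cost w (toℕ c) (toℕ b)

record Route (n : ℕ) : Set where
  field
    cost : (ℕ → ℕ) → ℕ → ℕ → ℕ
    cost-refl : ∀ w y → cost w y y ≡ 0
    step : ∀ (a b : Fin n) → a ≢ b → ∃ λ c → Cycle n a c × Peel n cost a b c

  walk : ∀ (a b : Fin n) → Σ (Walk (Cycle n) a b) λ p → ∀ w → weight w p ≡ cost w (toℕ a) (toℕ b)
  walk a b = follow (cost (const 1) (toℕ a) (toℕ b)) a b refl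
    where
    -- the unit-weight cost is the number of steps still to go
    follow : ∀ steps (a b : Fin n) → cost (const 1) (toℕ a) (toℕ b) ≡ steps →
      Σ (Walk (Cycle n) a b) λ p → ∀ w → weight w p ≡ cost w (toℕ a) (toℕ b)
    follow steps a b cost≡ with a ≟ᶠ b
    ... | yes refl = [] , λ w → sym (cost-refl w (toℕ a))
    ... | no a≢b with step a b a≢b | steps
    ...   | c , a~c , peel | zero = contradiction (trans (sym (peel (const 1))) cost≡) λ ()
    ...   | c , a~c , peel | suc steps′ with follow steps′ c b (suc-injective (trans (sym (peel (const 1))) cost≡))
    ...     | p , weight-p = a~c ∷ p , λ w → trans (cong (w (toℕ a) +_) (weight-p w)) (sym (peel w))

up-step : ∀ {n} (a b : Fin n) → a ≢ b → ∃ λ c → Cycle n a c × Peel n (λ w → up n w) a b c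
up-step {n} a b a≢b with suc (toℕ a) <? n
... | yes 1+a<n = fromℕ< 1+a<n , inj₁ (toℕ-fromℕ< 1+a<n) , λ w →
  trans (up-suc n w (a≢b ∘ toℕ-injective) 1+a<n) (cong (λ t → w (toℕ a) + up n w t (toℕ b)) (sym (toℕ-fromℕ< 1+a<n)))
up-step {suc n} a b a≢b | no 1+a≮n = fzero , inj₂ (inj₂ (inj₂ (refl , 1+a≡n))) , λ w →
  up-wrap (suc n) w (a≢b ∘ toℕ-injective) 1+a≡n (toℕ<n b)
  where
  1+a≡n : suc (toℕ a) ≡ suc n
  1+a≡n = ≤-antisym (toℕ<n a) (≮⇒≥ 1+a≮n)

down-step : ∀ {n} (a b : Fin n) → a ≢ b → ∃ λ c → Cycle n a c × Peel n (λ w → down n w) a b c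
down-step {suc n} fzero b 0≢b = fromℕ n , inj₂ (inj₂ (inj₁ (refl , cong suc (toℕ-fromℕ n)))) , λ w →
  down-wrap (suc n) w (0≢b ∘ toℕ-injective ∘ sym) (cong suc (toℕ-fromℕ n)) (toℕ<n b)
down-step (fsuc a) b a≢b = inject₁ a , inj₂ (inj₁ (cong suc (sym (toℕ-inject₁ a)))) , λ w →
  trans (down-suc _ w (a≢b ∘ toℕ-injective)) (cong (λ t → w (suc (toℕ a)) + down _ w t (toℕ b)) (sym (toℕ-inject₁ a)))

upRoute : ∀ {n} → Route n
upRoute {n} = record { cost = λ w → up n w ; cost-refl = λ w → up-refl n w ; step = up-step }

downRoute : ∀ {n} → Route n
downRoute {n} = record { cost = λ w → down n w ; cost-refl = λ w → down-refl n w ; step = down-step }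

visible-along : ∀ {n} k (X : Subset n) (R : Route n) {u v : Fin n} → u ∈ X → u ≢ v →
  Route.cost R (const 1) (toℕ u) (toℕ v) ≤ arcDist n (const 1) (toℕ u) (toℕ v) →
  Route.cost R (indicator X) (toℕ u) (toℕ v) ≤ suc k →
  Visible (Cycle n) X k u v
visible-along {n} k X R {u} {v} u∈X u≢v short light with Route.walk R u v
... | p , weight-p = p , shortest , s≤s⁻¹ few
  where
  open ≤-Reasoning
  shortest : IsShortest (Cycle n) p
  shortest q = begin
    len (Cycle n) p                          ≡⟨ trans (len≡weight-1 p) (weight-p (const 1)) ⟩
    Route.cost R (const 1) (toℕ u) (toℕ v)   ≤⟨ short ⟩
    arcDist n (const 1) (toℕ u) (toℕ v)      ≤⟨ arcDist≤weight n (const 1) q ⟩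
    weight (const 1) q                       ≡⟨ len≡weight-1 q ⟨
    len (Cycle n) q                          ∎
  few : suc (countIn (Cycle n) X (internal (Cycle n) p)) ≤ suc k
  few = begin
    suc (countIn (Cycle n) X (internal (Cycle n) p))  ≡⟨ weight-indicator≡suc-countIn u∈X u≢v p ⟨
    weight (indicator X) p                            ≡⟨ weight-p (indicator X) ⟩
    Route.cost R (indicator X) (toℕ u) (toℕ v)        ≤⟨ light ⟩
    suc k                                             ∎

visible⇒arcDist≤ : ∀ {n} k {X : Subset n} {u v} → Visible (Cycle n) X k u v → u ∈ X → u ≢ v →
  arcDist n (indicator X) (toℕ u) (toℕ v) ≤ suc k
visible⇒arcDist≤ {n} k {X} {u} {v} (q , _ , few) u∈X u≢v = begin
  arcDist n (indicator X) (toℕ u) (toℕ v)       ≤⟨ arcDist≤weight n (indicator X) q ⟩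
  weight (indicator X) q                        ≡⟨ weight-indicator≡suc-countIn u∈X u≢v q ⟩
  suc (countIn (Cycle n) X (internal (Cycle n) q)) ≤⟨ s≤s few ⟩
  suc k                                         ∎
  where open ≤-Reasoning

far-members : ∀ {n} k (X : Subset n) → 2 * k + 3 < ∣ X ∣ →
  ∃₂ λ u v → u ∈ X × v ∈ X × u ≢ v × suc (suc k) ≤ arcDist n (indicator X) (toℕ u) (toℕ v)
far-members {n} k X big with member-of-rank X {0} (≤-trans (s≤s z≤n) big)
                           | member-of-rank X {suc (suc k)} (≤-trans (s≤s k+2≤2k+3) big)
  where
  k+2≤2k+3 : suc (suc k) ≤ 2 * k + 3
  k+2≤2k+3 = subst (suc (suc k) ≤_) (solve 1 (λ k → con 2 :+ k :+ (k :+ con 1) := con 2 :* k :+ con 3) refl k) (m≤m+n _ (k + 1))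
... | u , u∈X , rank-u | v , v∈X , rank-v = u , v , u∈X , v∈X , u≢v , ⊓-glb (≤-reflexive (sym up≡k+2)) down-far
  where
  open ≤-Reasoning
  w = indicator X
  x = toℕ u
  y = toℕ v
  x<y : x < y
  x<y = ≰⇒> λ y≤x → contradiction (subst₂ _≤_ rank-v rank-u (prefixSum-mono w y≤x)) λ ()
  u≢v : u ≢ v
  u≢v refl = <-irrefl refl x<y
  up≡k+2 : up n w x y ≡ suc (suc k)
  up≡k+2 = trans (up-≤ n w (<⇒≤ x<y)) (cong₂ _∸_ rank-v rank-u)
  down-far : suc (suc k) ≤ down n w x y
  down-far = +-cancelˡ-≤ (suc (suc k)) _ _ (begin
    suc (suc k) + suc (suc k)  ≡⟨ solve 1 (λ k → con 2 :+ k :+ (con 2 :+ k) := con 1 :+ (con 2 :* k :+ con 3)) refl k ⟩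
    suc (2 * k + 3)            ≤⟨ big ⟩
    ∣ X ∣                      ≡⟨ ∣∣≡prefixSum-indicator X ⟩
    prefixSum w n              ≡⟨ up+down≡total n w (<⇒≢ x<y) (toℕ<n u) (toℕ<n v) (trans (indicator-∈ u∈X) (sym (indicator-∈ v∈X))) ⟨
    up n w x y + down n w x y  ≡⟨ cong (_+ down n w x y) up≡k+2 ⟩
    suc (suc k) + down n w x y ∎)

mutualVisible⇒∣∣≤2k+3 : ∀ {n} k (X : Subset n) → MutualVisible (Cycle n) k X → ∣ X ∣ ≤ 2 * k + 3
mutualVisible⇒∣∣≤2k+3 k X visible = ≮⇒≥ λ big →
  let u , v , u∈X , v∈X , u≢v , far = far-members k X big
  in 1+n≰n (≤-trans far (visible⇒arcDist≤ k (visible u v u∈X v∈X u≢v) u∈X u≢v))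

infix 4 _≈_within_

_≈_within_ : ℕ → ℕ → ℕ → Set
x ≈ y within ε = x < y + ε × y < x + ε

private
  <-from-residues : ∀ {n m x y r s} → x + r ≡ y + s → s < n → n ≤ r + m → x < y + m
  <-from-residues {n} {m} {x} {y} {r} {s} x+r≡y+s s<n n≤r+m = +-cancelʳ-< r x (y + m) (begin-strict
    x + r        ≡⟨ x+r≡y+s ⟩
    y + s        <⟨ +-monoʳ-< y s<n ⟩
    y + n        ≤⟨ +-monoʳ-≤ y n≤r+m ⟩
    y + (r + m)  ≡⟨ solve 3 (λ y r m → y :+ (r :+ m) := y :+ m :+ r) refl y r m ⟩
    y + m + r    ∎)
    where open ≤-Reasoning

  <-complement : ∀ {ε x y x′ y′} → y < x + ε → x + x′ ≡ y + y′ → x′ < y′ + ε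
  <-complement {ε} {x} {y} {x′} {y′} y<x+ε x+x′≡y+y′ = +-cancelˡ-< y x′ (y′ + ε) (begin-strict
    y + x′        <⟨ +-monoˡ-< x′ y<x+ε ⟩
    x + ε + x′    ≡⟨ solve 3 (λ x ε x′ → x :+ ε :+ x′ := x :+ x′ :+ ε) refl x ε x′ ⟩
    x + x′ + ε    ≡⟨ cong (_+ ε) x+x′≡y+y′ ⟩
    y + y′ + ε    ≡⟨ +-assoc y y′ ε ⟩
    y + (y′ + ε)  ∎)
    where open ≤-Reasoning

≈-from-residues : ∀ {n m x y r s} → x + r ≡ y + s → r < n → s < n → n ≤ r + m → n ≤ s + m → x ≈ y within m
≈-from-residues x+r≡y+s r<n s<n n≤r+m n≤s+m =
  <-from-residues x+r≡y+s s<n n≤r+m , <-from-residues (sym x+r≡y+s) r<n n≤s+m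

≈-complement : ∀ {ε x y x′ y′} → x ≈ y within ε → x + x′ ≡ y + y′ → x′ ≈ y′ within ε
≈-complement (x<y+ε , y<x+ε) x+x′≡y+y′ = <-complement y<x+ε x+x′≡y+y′ , <-complement x<y+ε (sym x+x′≡y+y′)

lighter⇒shorter : ∀ {m n ℓ ℓ′ c c′} → m ≤ n → ℓ * m ≈ c * n within m →
  ℓ + ℓ′ ≡ n → c + c′ ≡ m → c < c′ → ℓ ≤ ℓ′
lighter⇒shorter {m} {n} {ℓ} {ℓ′} {c} {c′} m≤n (ℓm<cn+m , _) ℓ+ℓ′≡n c+c′≡m c<c′ = ≮⇒≥ λ ℓ′<ℓ →
  <⇒≱ (n<m ℓ′<ℓ) m≤n
  where
  open ≤-Reasoning
  2c+1≤m : c + c + 1 ≤ m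
  2c+1≤m = begin
    c + c + 1    ≡⟨ solve 1 (λ c → c :+ c :+ con 1 := c :+ (con 1 :+ c)) refl c ⟩
    c + suc c    ≤⟨ +-monoʳ-≤ c c<c′ ⟩
    c + c′       ≡⟨ c+c′≡m ⟩
    m            ∎
  n<m : ℓ′ < ℓ → n < m
  n<m ℓ′<ℓ = +-cancelˡ-< (n * m + m) n m (begin-strict
    n * m + m + n                  ≡⟨ solve 2 (λ n m → n :* m :+ m :+ n := (n :+ con 1) :* m :+ n) refl n m ⟩
    (n + 1) * m + n                ≤⟨ +-monoˡ-≤ n (*-monoˡ-≤ m n+1≤2ℓ) ⟩
    (ℓ + ℓ) * m + n                ≡⟨ solve 3 (λ ℓ m n → (ℓ :+ ℓ) :* m :+ n := ℓ :* m :+ ℓ :* m :+ n) refl ℓ m n ⟩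
    ℓ * m + ℓ * m + n              <⟨ +-monoˡ-< n (+-mono-< ℓm<cn+m ℓm<cn+m) ⟩
    c * n + m + (c * n + m) + n    ≡⟨ solve 3 (λ c n m → c :* n :+ m :+ (c :* n :+ m) :+ n := (c :+ c :+ con 1) :* n :+ m :+ m) refl c n m ⟩
    (c + c + 1) * n + m + m        ≤⟨ +-monoˡ-≤ m (+-monoˡ-≤ m (*-monoˡ-≤ n 2c+1≤m)) ⟩
    m * n + m + m                  ≡⟨ solve 2 (λ m n → m :* n :+ m :+ m := n :* m :+ m :+ m) refl m n ⟩
    n * m + m + m                  ∎)
    where
    n+1≤2ℓ : n + 1 ≤ ℓ + ℓ
    n+1≤2ℓ = begin
      n + 1        ≡⟨ cong (_+ 1) ℓ+ℓ′≡n ⟨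
      ℓ + ℓ′ + 1   ≡⟨ solve 2 (λ ℓ ℓ′ → ℓ :+ ℓ′ :+ con 1 := ℓ :+ (con 1 :+ ℓ′)) refl ℓ ℓ′ ⟩
      ℓ + suc ℓ′   ≤⟨ +-monoʳ-≤ ℓ ℓ′<ℓ ⟩
      ℓ + ℓ        ∎

lesser-summand-≤ : ∀ {a b k} → a ≤ b → a + b ≤ 2 * k + 3 → a ≤ suc k
lesser-summand-≤ {a} {b} {k} a≤b a+b≤ = ≮⇒≥ λ k+1<a → 1+n≰n (begin
  suc (2 * k + 3)            ≡⟨ solve 1 (λ k → con 1 :+ (con 2 :* k :+ con 3) := (con 2 :+ k) :+ (con 2 :+ k)) refl k ⟩
  suc (suc k) + suc (suc k)  ≤⟨ +-mono-≤ k+1<a (≤-trans k+1<a a≤b) ⟩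
  a + b                      ≤⟨ a+b≤ ⟩
  2 * k + 3                  ∎)
  where open ≤-Reasoning

short-light-arc : ∀ {m n k ℓ ℓ′ c c′} → m ≤ n → m ≤ 2 * k + 3 → ℓ * m ≈ c * n within m →
  ℓ + ℓ′ ≡ n → c + c′ ≡ m → (ℓ ≤ ℓ′ × c ≤ suc k) ⊎ (ℓ′ ≤ ℓ × c′ ≤ suc k)
short-light-arc {m} {n} {k} {ℓ} {ℓ′} {c} {c′} m≤n m≤2k+3 close ℓ+ℓ′≡n c+c′≡m = choose (<-cmp c c′)
  where
  open ≤-Reasoning
  c+c′≤ : c + c′ ≤ 2 * k + 3
  c+c′≤ = subst (_≤ 2 * k + 3) (sym c+c′≡m) m≤2k+3
  close′ : ℓ′ * m ≈ c′ * n within m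
  close′ = ≈-complement close (begin-equality
    ℓ * m + ℓ′ * m   ≡⟨ *-distribʳ-+ m ℓ ℓ′ ⟨
    (ℓ + ℓ′) * m     ≡⟨ cong (_* m) ℓ+ℓ′≡n ⟩
    n * m            ≡⟨ *-comm n m ⟩
    m * n            ≡⟨ cong (_* n) c+c′≡m ⟨
    (c + c′) * n     ≡⟨ *-distribʳ-+ n c c′ ⟩
    c * n + c′ * n   ∎)
  choose : Tri (c < c′) (c ≡ c′) (c′ < c) → (ℓ ≤ ℓ′ × c ≤ suc k) ⊎ (ℓ′ ≤ ℓ × c′ ≤ suc k)
  choose (tri< c<c′ _ _) = inj₁ (lighter⇒shorter m≤n close ℓ+ℓ′≡n c+c′≡m c<c′ , lesser-summand-≤ (<⇒≤ c<c′) c+c′≤)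
  choose (tri> _ _ c′<c) = inj₂ (lighter⇒shorter m≤n close′ (trans (+-comm ℓ′ ℓ) ℓ+ℓ′≡n) (trans (+-comm c′ c) c+c′≡m) c′<c ,
                                 lesser-summand-≤ (<⇒≤ c′<c) (subst (_≤ 2 * k + 3) (+-comm c c′) c+c′≤))
  choose (tri≈ _ refl _) with ≤-total ℓ ℓ′
  ... | inj₁ ℓ≤ℓ′ = inj₁ (ℓ≤ℓ′ , lesser-summand-≤ ≤-refl c+c′≤)
  ... | inj₂ ℓ′≤ℓ = inj₂ (ℓ′≤ℓ , lesser-summand-≤ ≤-refl c+c′≤)

-- t ∈ X exactly when ⌊tm/n⌋ jumps at t (level-suc), which spreads the m members evenly.
module Bresenham (n m : ℕ) .{{_ : NonZero n}} (m≤n : m ≤ n) where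

  level : ℕ → ℕ
  level t = t * m / n

  residue : ℕ → ℕ
  residue t = t * m % n

  carries : ℕ → Bool
  carries t = does (n ≤? residue t + m)

  X : Subset n
  X = tabulate (carries ∘ toℕ)

  division : ∀ t → t * m ≡ residue t + level t * n
  division t = m≡m%n+[m/n]*n (t * m) n

  level-mono : ∀ {s t} → s ≤ t → level s ≤ level t
  level-mono s≤t = /-monoˡ-≤ n (*-monoˡ-≤ m s≤t)

  carry-quotient : ∀ t → (residue t + m) / n ≡ fromBool (carries t)
  carry-quotient t with n ≤? residue t + m
  ... | yes n≤r+m = begin-equality
    (residue t + m) / n            ≡⟨ m/n≡1+[m∸n]/n n≤r+m ⟩
    suc ((residue t + m ∸ n) / n)  ≡⟨ cong suc (m<n⇒m/n≡0 (m<n+o⇒m∸n<o (residue t + m) n r+m<n+n)) ⟩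
    1                              ≡⟨ cong fromBool (dec-true (n ≤? residue t + m) n≤r+m) ⟨
    fromBool (carries t)           ∎
    where
    open ≤-Reasoning
    r+m<n+n : residue t + m < n + n
    r+m<n+n = +-mono-<-≤ (m%n<n (t * m) n) m≤n
  ... | no n≰r+m = trans (m<n⇒m/n≡0 (≰⇒> n≰r+m)) (cong fromBool (sym (dec-false (n ≤? residue t + m) n≰r+m)))

  level-suc : ∀ t → level (suc t) ≡ level t + fromBool (carries t)
  level-suc t = begin-equality
    (m + t * m) / n                               ≡⟨ /-congˡ (cong (m +_) (division t)) ⟩
    (m + (residue t + level t * n)) / n           ≡⟨ /-congˡ (solve 3 (λ m r q → m :+ (r :+ q) := r :+ m :+ q) refl m (residue t) (level t * n)) ⟩
    (residue t + m + level t * n) / n             ≡⟨ +-distrib-/-∣ʳ (residue t + m) (n∣m*n (level t)) ⟩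
    (residue t + m) / n + level t * n / n         ≡⟨ cong₂ _+_ (carry-quotient t) (m*n/n≡m (level t) n) ⟩
    fromBool (carries t) + level t                ≡⟨ +-comm _ (level t) ⟩
    level t + fromBool (carries t)                ∎
    where open ≤-Reasoning

  prefixSum-indicator : ∀ {t} → t ≤ n → prefixSum (indicator X) t ≡ level t
  prefixSum-indicator {zero} _ = sym (0/n≡0 n)
  prefixSum-indicator {suc t} t<n = begin-equality
    prefixSum (indicator X) t + indicator X t     ≡⟨ cong₂ _+_ (prefixSum-indicator (<⇒≤ t<n)) (indicator-tabulate carries t<n) ⟩
    level t + fromBool (carries t)                ≡⟨ level-suc t ⟨
    level (suc t)                                 ∎
    where open ≤-Reasoning

  prefixSum-indicator-n : prefixSum (indicator X) n ≡ m
  prefixSum-indicator-n = trans (prefixSum-indicator ≤-refl) (trans (/-congˡ (*-comm n m)) (m*n/n≡m m n))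

  ∣X∣≡m : ∣ X ∣ ≡ m
  ∣X∣≡m = trans (∣∣≡prefixSum-indicator X) prefixSum-indicator-n

  ∈X⇒carry : ∀ {u} → u ∈ X → n ≤ residue (toℕ u) + m
  ∈X⇒carry {u} u∈X with n ≤? residue (toℕ u) + m
  ... | yes n≤r+m = n≤r+m
  ... | no n≰r+m = contradiction (trans (sym carries-u) (dec-false (n ≤? residue (toℕ u) + m) n≰r+m)) λ ()
    where
    carries-u : carries (toℕ u) ≡ true
    carries-u = trans (sym (lookup∘tabulate (carries ∘ toℕ) u)) ([]=⇒lookup u∈X)

  residues-balance : ∀ {x y} → x ≤ y → (y ∸ x) * m + residue x ≡ (level y ∸ level x) * n + residue y
  residues-balance {x} {y} x≤y = +-cancelʳ-≡ (level x * n) _ _ (begin-equality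
    (y ∸ x) * m + residue x + level x * n              ≡⟨ +-assoc ((y ∸ x) * m) _ _ ⟩
    (y ∸ x) * m + (residue x + level x * n)            ≡⟨ cong ((y ∸ x) * m +_) (division x) ⟨
    (y ∸ x) * m + x * m                                ≡⟨ *-distribʳ-+ m (y ∸ x) x ⟨
    (y ∸ x + x) * m                                    ≡⟨ cong (_* m) (m∸n+n≡m x≤y) ⟩
    y * m                                              ≡⟨ division y ⟩
    residue y + level y * n                            ≡⟨ cong (λ l → residue y + l * n) (m∸n+n≡m (level-mono x≤y)) ⟨
    residue y + (level y ∸ level x + level x) * n      ≡⟨ solve 4 (λ r c l n → r :+ (c :+ l) :* n := c :* n :+ r :+ l :* n) refl (residue y) (level y ∸ level x) (level x) n ⟩
    (level y ∸ level x) * n + residue y + level x * n  ∎)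
    where open ≤-Reasoning

  arc-≈< : ∀ {u v} → u ∈ X → v ∈ X → toℕ u < toℕ v →
    up n (const 1) (toℕ u) (toℕ v) * m ≈ up n (indicator X) (toℕ u) (toℕ v) * n within m
  arc-≈< {u} {v} u∈X v∈X x<y =
    subst₂ (λ ℓ c → ℓ * m ≈ c * n within m) (sym length≡) (sym weight≡)
      (≈-from-residues (residues-balance (<⇒≤ x<y)) (m%n<n (x * m) n) (m%n<n (y * m) n) (∈X⇒carry u∈X) (∈X⇒carry v∈X))
    where
    x = toℕ u
    y = toℕ v
    length≡ : up n (const 1) x y ≡ y ∸ x
    length≡ = trans (up-≤ n (const 1) (<⇒≤ x<y)) (cong₂ _∸_ (prefixSum-const-1 y) (prefixSum-const-1 x))
    weight≡ : up n (indicator X) x y ≡ level y ∸ level x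
    weight≡ = trans (up-≤ n (indicator X) (<⇒≤ x<y))
                    (cong₂ _∸_ (prefixSum-indicator (<⇒≤ (toℕ<n v))) (prefixSum-indicator (<⇒≤ (toℕ<n u))))

  arc-≈ : ∀ {u v} → u ∈ X → v ∈ X → u ≢ v →
    up n (const 1) (toℕ u) (toℕ v) * m ≈ up n (indicator X) (toℕ u) (toℕ v) * n within m
  arc-≈ {u} {v} u∈X v∈X u≢v with <-cmp (toℕ u) (toℕ v)
  ... | tri< x<y _ _ = arc-≈< u∈X v∈X x<y
  ... | tri≈ _ x≡y _ = contradiction (toℕ-injective x≡y) u≢v
  ... | tri> _ _ y<x = ≈-complement (arc-≈< v∈X u∈X y<x) (begin-equality
    ℓ v u * m + ℓ u v * m          ≡⟨ *-distribʳ-+ m (ℓ v u) (ℓ u v) ⟨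
    (ℓ v u + ℓ u v) * m            ≡⟨ cong (_* m) (trans (up+up-flip n (const 1) (<⇒≢ y<x) (toℕ<n v) (toℕ<n u)) (prefixSum-const-1 n)) ⟩
    n * m                          ≡⟨ *-comm n m ⟩
    m * n                          ≡⟨ cong (_* n) (trans (up+up-flip n (indicator X) (<⇒≢ y<x) (toℕ<n v) (toℕ<n u)) prefixSum-indicator-n) ⟨
    (c v u + c u v) * n            ≡⟨ *-distribʳ-+ n (c v u) (c u v) ⟩
    c v u * n + c u v * n          ∎)
    where
    open ≤-Reasoning
    ℓ c : Fin n → Fin n → ℕ
    ℓ a b = up n (const 1) (toℕ a) (toℕ b)
    c a b = up n (indicator X) (toℕ a) (toℕ b)

  mutualVisible : ∀ k → m ≤ 2 * k + 3 → MutualVisible (Cycle n) k X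
  mutualVisible k m≤2k+3 u v u∈X v∈X u≢v with short-light-arc m≤n m≤2k+3 (arc-≈ u∈X v∈X u≢v) lengths weights
    where
    x≢y : toℕ u ≢ toℕ v
    x≢y = u≢v ∘ toℕ-injective
    lengths : up n (const 1) (toℕ u) (toℕ v) + down n (const 1) (toℕ u) (toℕ v) ≡ n
    lengths = trans (up+down≡total n (const 1) x≢y (toℕ<n u) (toℕ<n v) refl) (prefixSum-const-1 n)
    weights : up n (indicator X) (toℕ u) (toℕ v) + down n (indicator X) (toℕ u) (toℕ v) ≡ m
    weights = trans (up+down≡total n (indicator X) x≢y (toℕ<n u) (toℕ<n v) (trans (indicator-∈ u∈X) (sym (indicator-∈ v∈X))))
                    prefixSum-indicator-n
  ... | inj₁ (shorter , light) = visible-along k X upRoute u∈X u≢v (⊓-glb ≤-refl shorter) light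
  ... | inj₂ (shorter , light) = visible-along k X downRoute u∈X u≢v (⊓-glb shorter ≤-refl) light

proposition4p3 : (n k : ℕ) → 3 ≤ n → k ≤ n ∸ 2 →
    IsMu (Cycle n) k (n ⊓ (2 * k + 3))
proposition4p3 n k 3≤n _ =
  (X , mutualVisible k (m⊓n≤n n (2 * k + 3)) , ∣X∣≡m) ,
  λ Y visible → ⊓-glb (∣p∣≤n Y) (mutualVisible⇒∣∣≤2k+3 k Y visible)
  where
  instance
    n≢0 : NonZero n
    n≢0 = >-nonZero (≤-trans (s≤s z≤n) 3≤n)
  open Bresenham n (n ⊓ (2 * k + 3)) (m⊓n≤m n (2 * k + 3))
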